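{- Let $\Gamma$ be the incidence graph of a quasi-symmetric $(v,b,r,k,\lambda_1,0)$ SPBIBD $\mathcal D=(\mathcal P,\mathcal B,\mathcal I)$ of type $(k-1,t)$ with intersection numbers $x=0$ and $y=1$, and assume $r\ge 3$. Then: (i) $\Gamma$ is almost $2$-$\mathcal B$-homogeneous if and only if $\mathcal D$ is a generalized quadrangle; (ii) $\Gamma$ is not $2$-$\mathcal B$-homogeneous.
   Context: An incidence structure $\mathcal D=(\mathcal P,\mathcal B,\mathcal I)$ has finite point set $\mathcal P$, block set $\mathcal B$, incidence $\mathcal I\subseteq\mathcal P\times\mathcal B$ (write $p\in B$). $(p,B)$ is a flag if $p\in B$, a non-flag otherwise. A $(v,b,r,k,\lambda_1,\lambda_2)$ SPBIBD of type $(s,t)$: $|\mathcal P|=v$, $|\mathcal B|=b$, each block has $k$ points, each point lies in $r$ blocks; any two distinct points lie together in exactly $\lambda_1$ or exactly $\lambda_2$ blocks; for every flag $(p,B)$ exactly $s$ points of $B$ other than $p$ lie together with $p$ in exactly $\lambda_1$ blocks; for every non-flag $(p,B)$ exactly $t$ points of $B$ lie together with $p$ in exactly $\lambda_1$ blocks. Standing assumptions: $v>k\ge2$, $r<b$. Quasi-symmetric with intersection numbers $x<y$: any two distinct blocks share exactly $x$ or $y$ points, and both values occur. A partial geometry $(r,k,t)$ is a design with each point on $r$ blocks and each block of size $k$ in which any two points lie together in at most one block and, for every non-flag $(p,B)$, exactly $t$ blocks through $p$ meet $B$; a generalized quadrangle is a partial geometry with $t=1$. The incidence graph is the bipartite graph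 on $\mathcal P\cup\mathcal B$ with $p\sim B$ iff $p\in B$. In a graph, $\Gamma_i(u)$ is the set of vertices at distance $i$ from $u$ and $\Gamma(u)=\Gamma_1(u)$. For a bipartite graph with color classes $Y,Y'$ in which every vertex of $Y$ has eccentricity $D\ge3$: it is almost $2$-$Y$-homogeneous if for every $1\le i\le D-2$ and all $x\in Y$, $y\in\Gamma_2(x)$, $z\in\Gamma_i(x)\cap\Gamma_i(y)$, the number $|\Gamma(x)\cap\Gamma(y)\cap\Gamma_{i-1}(z)|$ is independent of $x,y,z$; it is $2$-$Y$-homogeneous if the same holds for every $1\le i\le D-1$. (Here $Y=\mathcal B$, of eccentricity $4$.) -}

module Defs where

open import Data.Nat using (ℕ; zero; suc; _+_; _∸_; _≤_; _<_)
open import Data.Bool using (Bool; true; false; _∧_; _∨_; not; if_then_else_; T)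
open import Data.Fin using (Fin; zero; suc)
open import Data.Sum using (_⊎_; inj₁; inj₂)
open import Data.Product using (_×_; Σ; ∃; ∃-syntax; _,_)
open import Relation.Nullary using (¬_)
open import Relation.Nullary.Decidable using (⌊_⌋)
open import Relation.Binary.PropositionalEquality using (_≡_)
import Data.Fin as F

countF : ∀ {n} → (Fin n → Bool) → ℕ
countF {zero}  f = 0
countF {suc n} f = (if f zero then 1 else 0) + countF (λ i → f (suc i))

anyF : ∀ {n} → (Fin n → Bool) → Bool
anyF {zero}  f = false
anyF {suc n} f = f zero ∨ anyF (λ i → f (suc i))

eqF : ∀ {n} → Fin n → Fin n → Bool
eqF i j = ⌊ i F.≟ j ⌋

Incidence : ℕ → ℕ → Set
Incidence v b = Fin v → Fin b → Bool

module _ {v b : ℕ} (I : Incidence v b) where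

  lam : Fin v → Fin v → ℕ
  lam p q = countF (λ B → I p B ∧ I q B)

  sCount : ℕ → Fin v → Fin b → ℕ
  sCount λ₁ p B = countF (λ q → I q B ∧ not (eqF q p) ∧ ⌊ lam p q Data.Nat.≟ λ₁ ⌋)

  record IsSPBIBD (r k λ₁ λ₂ s t : ℕ) : Set where
    field
      v>k        : k < v
      k≥2        : 2 ≤ k
      r<b        : r < b
      blockSize  : ∀ (B : Fin b) → countF (λ p → I p B) ≡ k
      replication : ∀ (p : Fin v) → countF (λ B → I p B) ≡ r
      pairs      : ∀ (p q : Fin v) → ¬ (p ≡ q) → (lam p q ≡ λ₁) ⊎ (lam p q ≡ λ₂)
      flagCond   : ∀ (p : Fin v) (B : Fin b) → T (I p B) → sCount λ₁ p B ≡ s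
      nonFlagCond : ∀ (p : Fin v) (B : Fin b) → T (not (I p B)) → sCount λ₁ p B ≡ t

  meet : Fin b → Fin b → ℕ
  meet B C = countF (λ p → I p B ∧ I p C)

  record IsQuasiSymmetric (x y : ℕ) : Set where
    field
      x<y      : x < y
      twoVals  : ∀ (B C : Fin b) → ¬ (B ≡ C) → (meet B C ≡ x) ⊎ (meet B C ≡ y)
      xOccurs  : ∃[ B ] ∃[ C ] (¬ (B ≡ C) × meet B C ≡ x)
      yOccurs  : ∃[ B ] ∃[ C ] (¬ (B ≡ C) × meet B C ≡ y)

  record IsPartialGeometry (r k t : ℕ) : Set where
    field
      replication : ∀ (p : Fin v) → countF (λ B → I p B) ≡ r
      blockSize   : ∀ (B : Fin b) → countF (λ p → I p B) ≡ k
      atMostOne   : ∀ (p q : Fin v) → ¬ (p ≡ q) → lam p q ≤ 1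
      nonFlag     : ∀ (p : Fin v) (B : Fin b) → T (not (I p B)) →
                    countF (λ C → I p C ∧ anyF (λ q → I q C ∧ I q B)) ≡ t

  IsGeneralizedQuadrangle : Set
  IsGeneralizedQuadrangle = ∃[ r ] ∃[ k ] IsPartialGeometry r k 1

  Vertex : Set
  Vertex = Fin v ⊎ Fin b

  adj : Vertex → Vertex → Bool
  adj (inj₁ p) (inj₁ q) = false
  adj (inj₁ p) (inj₂ B) = I p B
  adj (inj₂ B) (inj₁ p) = I p B
  adj (inj₂ B) (inj₂ C) = false

  eqV : Vertex → Vertex → Bool
  eqV (inj₁ p) (inj₁ q) = eqF p q
  eqV (inj₁ p) (inj₂ C) = false
  eqV (inj₂ B) (inj₁ q) = false
  eqV (inj₂ B) (inj₂ C) = eqF B C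

  anyV : (Vertex → Bool) → Bool
  anyV f = anyF (λ p → f (inj₁ p)) ∨ anyF (λ B → f (inj₂ B))

  countV : (Vertex → Bool) → ℕ
  countV f = countF (λ p → f (inj₁ p)) + countF (λ B → f (inj₂ B))

  reach : ℕ → Vertex → Vertex → Bool
  reach zero    u w = eqV u w
  reach (suc n) u w = reach n u w ∨ anyV (λ w' → reach n u w' ∧ adj w' w)

  inΓ : ℕ → Vertex → Vertex → Bool
  inΓ zero    u w = reach zero u w
  inΓ (suc i) u w = reach (suc i) u w ∧ not (reach i u w)

  HomUpTo : ℕ → Set
  HomUpTo m = ∀ (i : ℕ) → 1 ≤ i → i ≤ m → ∃[ c ]
      ∀ (x y : Fin b) (z : Vertex) →
        T (inΓ 2 (inj₂ x) (inj₂ y)) →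
        T (inΓ i (inj₂ x) z) → T (inΓ i (inj₂ y) z) →
        countV (λ w → adj (inj₂ x) w ∧ adj (inj₂ y) w ∧ inΓ (i ∸ 1) z w) ≡ c

  -- D = eccentricity of the vertices of Y = B
  IsAlmost2BHomogeneous : ℕ → Set
  IsAlmost2BHomogeneous D = HomUpTo (D ∸ 2)

  Is2BHomogeneous : ℕ → Set
  Is2BHomogeneous D = HomUpTo (D ∸ 1)

{-# OPTIONS --safe #-}
-- Since two blocks meet in at most one point, two blocks x, y at distance 2 have a
-- unique common neighbour p, so every count |Γ(x) ∩ Γ(y) ∩ Γ_{i-1}(z)| is 1 or 0
-- according to whether p lies in Γ_{i-1}(z).  For i = 2 and z a block this asks
-- whether z passes through p: homogeneity holds iff every block meeting both x and y
-- passes through p, i.e. iff there are no triangles, and since every non-flag (p, B)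
-- has a point of B collinear with p (t ≥ 1) this is exactly the generalized
-- quadrangle axiom.  For i = 3 and z a point, the count asks whether z is collinear
-- with p, and with r ≥ 3 there are points at distance 3 from x and y of both kinds.
module Submission where

open import Defs
open import Data.Bool using (Bool; true; false; _∧_; not; T)
open import Data.Bool.Properties using (T-∧; T-∨; T-≡)
open import Data.Empty using (⊥-elim)
open import Data.Fin using (Fin; zero; suc)
open import Data.Fin.Properties using (_≟_; 0≢1+n; suc-injective)
open import Data.Nat using (ℕ; zero; suc; _+_; _∸_; _≤_; z≤n; s≤s)
open import Data.Nat.Properties
  using ( ≤-refl; ≤-trans; ≤-antisym; ≤-reflexive; ≤-pred; n≤1+n
        ; +-suc; +-identityʳ; +-mono-≤; +-monoˡ-≤)
  renaming (_≟_ to _≟ℕ_)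
open import Data.Product using (_×_; ∃-syntax; _,_; proj₁; proj₂)
open import Data.Sum using (_⊎_; inj₁; inj₂; [_,_]; fromInj₂)
open import Function.Bundles using (_⇔_; mk⇔; Equivalence)
open import Relation.Nullary using (¬_; yes; no; contradiction)
open import Relation.Nullary.Decidable using (⌊_⌋; toWitness; fromWitness; toWitnessFalse; fromWitnessFalse)
open import Relation.Binary.PropositionalEquality using (_≡_; _≢_; refl; sym; trans; cong; subst; ≢-sym)

open Equivalence using (to; from)

private variable
  n : ℕ

T-not⇒¬T : ∀ {b} → T (not b) → ¬ T b
T-not⇒¬T {true} ()

¬T⇒T-not : ∀ {b} → ¬ T b → T (not b)
¬T⇒T-not {false} _  = _
¬T⇒T-not {true}  ¬t = ¬t _

eqF-sound : {i j : Fin n} → T (eqF i j) → i ≡ j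
eqF-sound {i = i} {j} = toWitness {a? = i ≟ j}

eqF-refl : (i : Fin n) → T (eqF i i)
eqF-refl i = fromWitness {a? = i ≟ i} refl

eqF-≢ : {i j : Fin n} → i ≢ j → T (not (eqF i j))
eqF-≢ {i = i} {j} = fromWitnessFalse {a? = i ≟ j}

eqF-≢⁻ : {i j : Fin n} → T (not (eqF i j)) → i ≢ j
eqF-≢⁻ {i = i} {j} = toWitnessFalse {a? = i ≟ j}

anyF-intro : (f : Fin n → Bool) {i : Fin n} → T (f i) → T (anyF f)
anyF-intro f {zero}  fi = from T-∨ (inj₁ fi)
anyF-intro f {suc i} fi = from T-∨ (inj₂ (anyF-intro (λ j → f (suc j)) fi))

anyF-witness : (f : Fin n → Bool) → T (anyF f) → ∃[ i ] T (f i)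
anyF-witness {suc n} f any with to T-∨ any
... | inj₁ f0   = zero , f0
... | inj₂ rest = let i , fi = anyF-witness (λ j → f (suc j)) rest in suc i , fi

countF-≡0 : (f : Fin n → Bool) → (∀ i → ¬ T (f i)) → countF f ≡ 0
countF-≡0 {zero}  f none = refl
countF-≡0 {suc n} f none with f zero | none zero
... | true  | ¬f0 = ⊥-elim (¬f0 _)
... | false | _   = countF-≡0 (λ i → f (suc i)) (λ i → none (suc i))

countF-≥1 : (f : Fin n → Bool) {i : Fin n} → T (f i) → 1 ≤ countF f
countF-≥1 f {zero}  fi with f zero
... | true = s≤s z≤n
countF-≥1 f {suc i} fi with f zero
... | true  = s≤s z≤n
... | false = countF-≥1 (λ j → f (suc j)) fi

countF-witness : (f : Fin n → Bool) → 1 ≤ countF f → ∃[ i ] T (f i)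
countF-witness {suc n} f pos with f zero in f0
... | true  = zero , from T-≡ f0
... | false = let i , fi = countF-witness (λ j → f (suc j)) pos in suc i , fi

countF-≤1 : (f : Fin n → Bool) → (∀ {i j} → T (f i) → T (f j) → i ≡ j) → countF f ≤ 1
countF-≤1 {zero}  f unique = z≤n
countF-≤1 {suc n} f unique with f zero in f0
... | true  =
  ≤-reflexive (cong suc (countF-≡0 (λ j → f (suc j)) (λ i fi → 0≢1+n (unique (from T-≡ f0) fi))))
... | false = countF-≤1 (λ j → f (suc j)) (λ fi fj → suc-injective (unique fi fj))

countF-≡1 : (f : Fin n → Bool) {a : Fin n} → T (f a) → (∀ {i} → T (f i) → i ≡ a) → countF f ≡ 1
countF-≡1 f fa unique =
  ≤-antisym (countF-≤1 f (λ fi fj → trans (unique fi) (sym (unique fj)))) (countF-≥1 f fa)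

countF-split : (f g : Fin n → Bool) →
               countF f ≡ countF (λ i → f i ∧ g i) + countF (λ i → f i ∧ not (g i))
countF-split {zero}  f g = refl
countF-split {suc n} f g with f zero | g zero | countF-split (λ i → f (suc i)) (λ i → g (suc i))
... | true  | true  | split = cong suc split
... | true  | false | split = trans (cong suc split) (sym (+-suc _ _))
... | false | _     | split = split

countF-≤1+avoiding : (f : Fin n → Bool) (a : Fin n) → countF f ≤ suc (countF (λ i → f i ∧ not (eqF i a)))
countF-≤1+avoiding f a =
  ≤-trans (≤-reflexive (countF-split f (λ i → eqF i a)))
          (+-monoˡ-≤ _ (countF-≤1 (λ i → f i ∧ eqF i a) atA))
  where
  atA : ∀ {i j} → T (f i ∧ eqF i a) → T (f j ∧ eqF j a) → i ≡ j
  atA i≡a j≡a = trans (eqF-sound (proj₂ (to T-∧ i≡a))) (sym (eqF-sound (proj₂ (to T-∧ j≡a))))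

countF-≤1⇒unique : (f : Fin n → Bool) → countF f ≤ 1 → ∀ {i j} → T (f i) → T (f j) → i ≡ j
countF-≤1⇒unique f ≤1 {i} {j} fi fj with i ≟ j
... | yes i≡j = i≡j
... | no  i≢j = contradiction (≤-trans two ≤1) λ { (s≤s ()) }
  where
  two : 2 ≤ countF f
  two = ≤-trans (+-mono-≤ (countF-≥1 (λ k → f k ∧ eqF k i) (from T-∧ (fi , eqF-refl i)))
                          (countF-≥1 (λ k → f k ∧ not (eqF k i)) (from T-∧ (fj , eqF-≢ (≢-sym i≢j)))))
                (≤-reflexive (sym (countF-split f (λ k → eqF k i))))

countF-other : (f : Fin n → Bool) (a : Fin n) → 2 ≤ countF f → ∃[ i ] (T (f i) × i ≢ a)
countF-other f a two =
  let i , fi∧i≢a = countF-witness (λ i → f i ∧ not (eqF i a))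
                                  (≤-pred (≤-trans two (countF-≤1+avoiding f a)))
      fi , i≢a = to T-∧ fi∧i≢a
  in i , fi , eqF-≢⁻ i≢a

countF-other₂ : (f : Fin n → Bool) (a a' : Fin n) → 3 ≤ countF f → ∃[ i ] (T (f i) × i ≢ a × i ≢ a')
countF-other₂ f a a' three =
  let i , fi∧i≢a , i≢a' = countF-other (λ i → f i ∧ not (eqF i a)) a'
                                       (≤-pred (≤-trans three (countF-≤1+avoiding f a)))
      fi , i≢a = to T-∧ fi∧i≢a
  in i , fi , eqF-≢⁻ i≢a , i≢a'

module IncidenceGraph {v b : ℕ} (I : Incidence v b) where

  infix 4 _∈_

  _∈_ : Fin v → Fin b → Set
  p ∈ B = T (I p B)

  Collinear : Fin v → Fin v → Set
  Collinear p q = ∃[ C ] (p ∈ C × q ∈ C)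

  Meeting : Fin b → Fin b → Set
  Meeting B C = ∃[ p ] (p ∈ B × p ∈ C)

  anyV-intro : (f : Vertex I → Bool) {w : Vertex I} → T (f w) → T (anyV I f)
  anyV-intro f {inj₁ p} fp = from T-∨ (inj₁ (anyF-intro (λ q → f (inj₁ q)) fp))
  anyV-intro f {inj₂ B} fB = from T-∨ (inj₂ (anyF-intro (λ C → f (inj₂ C)) fB))

  anyV-witness : (f : Vertex I → Bool) → T (anyV I f) → ∃[ w ] T (f w)
  anyV-witness f any with to T-∨ any
  ... | inj₁ anyP = let p , fp = anyF-witness (λ q → f (inj₁ q)) anyP in inj₁ p , fp
  ... | inj₂ anyB = let B , fB = anyF-witness (λ C → f (inj₂ C)) anyB in inj₂ B , fB

  reach-refl : ∀ m (u : Vertex I) → T (reach I m u u)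
  reach-refl zero    (inj₁ p) = eqF-refl p
  reach-refl zero    (inj₂ B) = eqF-refl B
  reach-refl (suc m) u        = from (T-∨ {reach I m u u}) (inj₁ (reach-refl m u))

  unreachable⇒≢ : ∀ m {u w} → T (not (reach I m u w)) → u ≢ w
  unreachable⇒≢ m {u} ¬r refl = T-not⇒¬T ¬r (reach-refl m u)

  reach-step : ∀ m u w' w → T (reach I m u w') → T (adj I w' w) → T (reach I (suc m) u w)
  reach-step m u w' w r a =
    from (T-∨ {reach I m u w})
         (inj₂ (anyV-intro (λ w'' → reach I m u w'' ∧ adj I w'' w) (from T-∧ (r , a))))

  reach-suc⁻ : ∀ m u w → T (reach I (suc m) u w) →
               T (reach I m u w) ⊎ ∃[ w' ] (T (reach I m u w') × T (adj I w' w))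
  reach-suc⁻ m u w r with to T-∨ r
  ... | inj₁ r′ = inj₁ r′
  ... | inj₂ s  = let w' , rw'∧a = anyV-witness (λ w' → reach I m u w' ∧ adj I w' w) s in
                  inj₂ (w' , to T-∧ rw'∧a)

  inΓ-suc⁻ : ∀ m u w → T (inΓ I (suc m) u w) → T (reach I (suc m) u w) × T (not (reach I m u w))
  inΓ-suc⁻ m u w = to (T-∧ {reach I (suc m) u w})

  inΓ-suc⁺ : ∀ m u w → T (reach I (suc m) u w) → ¬ T (reach I m u w) → T (inΓ I (suc m) u w)
  inΓ-suc⁺ m u w r ¬r = from (T-∧ {reach I (suc m) u w}) (r , ¬T⇒T-not ¬r)

  reach₁-bl-bl : ∀ {x y} → T (reach I 1 (inj₂ x) (inj₂ y)) → x ≡ y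
  reach₁-bl-bl {x} {y} r with reach-suc⁻ 0 (inj₂ x) (inj₂ y) r
  ... | inj₁ x≡y               = eqF-sound x≡y
  ... | inj₂ (inj₁ _ , () , _)
  ... | inj₂ (inj₂ _ , _ , ())

  reach₁-pt-pt : ∀ {p q} → T (reach I 1 (inj₁ p) (inj₁ q)) → p ≡ q
  reach₁-pt-pt {p} {q} r with reach-suc⁻ 0 (inj₁ p) (inj₁ q) r
  ... | inj₁ p≡q               = eqF-sound p≡q
  ... | inj₂ (inj₁ _ , _ , ())
  ... | inj₂ (inj₂ _ , () , _)

  reach₁-bl-pt : ∀ {x p} → T (reach I 1 (inj₂ x) (inj₁ p)) → p ∈ x
  reach₁-bl-pt {x} {p} r with reach-suc⁻ 0 (inj₂ x) (inj₁ p) r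
  ... | inj₁ ()
  ... | inj₂ (inj₁ _ , () , _)
  ... | inj₂ (inj₂ C , x≡C , pC) = subst (p ∈_) (sym (eqF-sound x≡C)) pC

  reach₁-pt-bl : ∀ {p B} → T (reach I 1 (inj₁ p) (inj₂ B)) → p ∈ B
  reach₁-pt-bl {p} {B} r with reach-suc⁻ 0 (inj₁ p) (inj₂ B) r
  ... | inj₁ ()
  ... | inj₂ (inj₂ _ , () , _)
  ... | inj₂ (inj₁ q , p≡q , qB) = subst (_∈ B) (sym (eqF-sound p≡q)) qB

  reach₂-bl-pt : ∀ {x p} → T (reach I 2 (inj₂ x) (inj₁ p)) → p ∈ x
  reach₂-bl-pt {x} {p} r with reach-suc⁻ 1 (inj₂ x) (inj₁ p) r
  ... | inj₁ r₁                  = reach₁-bl-pt r₁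
  ... | inj₂ (inj₁ _ , _ , ())
  ... | inj₂ (inj₂ C , r₁ , pC) = subst (p ∈_) (sym (reach₁-bl-bl r₁)) pC

  reach₂-bl-bl : ∀ {x y} → T (reach I 2 (inj₂ x) (inj₂ y)) → x ≡ y ⊎ Meeting x y
  reach₂-bl-bl {x} {y} r with reach-suc⁻ 1 (inj₂ x) (inj₂ y) r
  ... | inj₁ r₁                  = inj₁ (reach₁-bl-bl r₁)
  ... | inj₂ (inj₁ q , r₁ , qy) = inj₂ (q , reach₁-bl-pt r₁ , qy)
  ... | inj₂ (inj₂ _ , _ , ())

  reach₂-pt-pt : ∀ {p q} → T (reach I 2 (inj₁ p) (inj₁ q)) → p ≡ q ⊎ Collinear p q
  reach₂-pt-pt {p} {q} r with reach-suc⁻ 1 (inj₁ p) (inj₁ q) r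
  ... | inj₁ r₁                  = inj₁ (reach₁-pt-pt r₁)
  ... | inj₂ (inj₁ _ , _ , ())
  ... | inj₂ (inj₂ C , r₁ , qC) = inj₂ (C , reach₁-pt-bl r₁ , qC)

  reach₁-bl-pt⁺ : ∀ {x p} → p ∈ x → T (reach I 1 (inj₂ x) (inj₁ p))
  reach₁-bl-pt⁺ {x} {p} = reach-step 0 (inj₂ x) (inj₂ x) (inj₁ p) (reach-refl 0 (inj₂ x))

  reach₂-bl-bl⁺ : ∀ {x y} → Meeting x y → T (reach I 2 (inj₂ x) (inj₂ y))
  reach₂-bl-bl⁺ {x} {y} (p , px , py) = reach-step 1 (inj₂ x) (inj₁ p) (inj₂ y) (reach₁-bl-pt⁺ px) py

  reach₂-pt-pt⁺ : ∀ {p q} → Collinear p q → T (reach I 2 (inj₁ p) (inj₁ q))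
  reach₂-pt-pt⁺ {p} {q} (C , pC , qC) =
    reach-step 1 (inj₁ p) (inj₂ C) (inj₁ q)
      (reach-step 0 (inj₁ p) (inj₁ p) (inj₂ C) (reach-refl 0 (inj₁ p)) pC) qC

  inΓ₁-bl-pt : ∀ {x p} → T (inΓ I 1 (inj₂ x) (inj₁ p)) ⇔ p ∈ x
  inΓ₁-bl-pt {x} {p} = mk⇔ (λ Γ₁ → reach₁-bl-pt (proj₁ (inΓ-suc⁻ 0 (inj₂ x) (inj₁ p) Γ₁)))
                           (λ px → inΓ-suc⁺ 0 (inj₂ x) (inj₁ p) (reach₁-bl-pt⁺ px) λ ())

  ¬inΓ₁-bl-bl : ∀ {x y} → ¬ T (inΓ I 1 (inj₂ x) (inj₂ y))
  ¬inΓ₁-bl-bl {x} {y} Γ₁ =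
    let r₁ , ¬r₀ = inΓ-suc⁻ 0 (inj₂ x) (inj₂ y) Γ₁
    in unreachable⇒≢ 0 ¬r₀ (cong inj₂ (reach₁-bl-bl r₁))

  ¬inΓ₂-bl-pt : ∀ {x p} → ¬ T (inΓ I 2 (inj₂ x) (inj₁ p))
  ¬inΓ₂-bl-pt {x} {p} Γ₂ =
    let r₂ , ¬r₁ = inΓ-suc⁻ 1 (inj₂ x) (inj₁ p) Γ₂
    in T-not⇒¬T ¬r₁ (reach₁-bl-pt⁺ (reach₂-bl-pt r₂))

  inΓ₂-bl-bl : ∀ {x y} → T (inΓ I 2 (inj₂ x) (inj₂ y)) ⇔ (x ≢ y × Meeting x y)
  inΓ₂-bl-bl {x} {y} = mk⇔ split (λ (x≢y , meet) →
    inΓ-suc⁺ 1 (inj₂ x) (inj₂ y) (reach₂-bl-bl⁺ meet) (λ r₁ → x≢y (reach₁-bl-bl r₁)))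
    where
    split : T (inΓ I 2 (inj₂ x) (inj₂ y)) → x ≢ y × Meeting x y
    split Γ₂ with inΓ-suc⁻ 1 (inj₂ x) (inj₂ y) Γ₂
    ... | r₂ , ¬r₁ = x≢y , fromInj₂ (λ x≡y → contradiction x≡y x≢y) (reach₂-bl-bl r₂)
      where
      x≢y : x ≢ y
      x≢y x≡y = unreachable⇒≢ 1 ¬r₁ (cong inj₂ x≡y)

  inΓ₂-pt-pt : ∀ {p q} → T (inΓ I 2 (inj₁ p) (inj₁ q)) ⇔ (p ≢ q × Collinear p q)
  inΓ₂-pt-pt {p} {q} = mk⇔ split (λ (p≢q , col) →
    inΓ-suc⁺ 1 (inj₁ p) (inj₁ q) (reach₂-pt-pt⁺ col) (λ r₁ → p≢q (reach₁-pt-pt r₁)))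
    where
    split : T (inΓ I 2 (inj₁ p) (inj₁ q)) → p ≢ q × Collinear p q
    split Γ₂ with inΓ-suc⁻ 1 (inj₁ p) (inj₁ q) Γ₂
    ... | r₂ , ¬r₁ = p≢q , fromInj₂ (λ p≡q → contradiction p≡q p≢q) (reach₂-pt-pt r₂)
      where
      p≢q : p ≢ q
      p≢q p≡q = unreachable⇒≢ 1 ¬r₁ (cong inj₁ p≡q)

  inΓ₃-bl-pt⁺ : ∀ {x C z} → Meeting x C → z ∈ C → ¬ z ∈ x → T (inΓ I 3 (inj₂ x) (inj₁ z))
  inΓ₃-bl-pt⁺ {x} {C} {z} meet zC z∉x =
    inΓ-suc⁺ 2 (inj₂ x) (inj₁ z) (reach-step 2 (inj₂ x) (inj₂ C) (inj₁ z) (reach₂-bl-bl⁺ meet) zC)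
             (λ r₂ → z∉x (reach₂-bl-pt r₂))

  commonCount : ℕ → Fin b → Fin b → Vertex I → ℕ
  commonCount i x y z = countV I (λ w → adj I (inj₂ x) w ∧ adj I (inj₂ y) w ∧ inΓ I (i ∸ 1) z w)

  HomAt : ℕ → Set
  HomAt i = ∃[ c ] ∀ (x y : Fin b) (z : Vertex I) →
    T (inΓ I 2 (inj₂ x) (inj₂ y)) → T (inΓ I i (inj₂ x) z) → T (inΓ I i (inj₂ y) z) →
    commonCount i x y z ≡ c

  commonPoint⁻ : ∀ {w x y} φ → T (I w x ∧ I w y ∧ φ) → w ∈ x × w ∈ y × T φ
  commonPoint⁻ {w} {x} {y} φ t =
    let wx , rest = to (T-∧ {I w x}) t
        wy , φt = to (T-∧ {I w y}) rest
    in wx , wy , φt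

  commonCount-points : ∀ i x y z →
    commonCount i x y z ≡ countF (λ p → I p x ∧ I p y ∧ inΓ I (i ∸ 1) z (inj₁ p))
  commonCount-points i x y z =
    trans (cong (countF (λ p → I p x ∧ I p y ∧ inΓ I (i ∸ 1) z (inj₁ p)) +_)
                (countF-≡0 {n = b} (λ _ → false) λ _ ()))
          (+-identityʳ _)

  homAt-constant : ∀ i → HomAt i → ∀ x y z x' y' z' →
    T (inΓ I 2 (inj₂ x) (inj₂ y)) → T (inΓ I i (inj₂ x) z) → T (inΓ I i (inj₂ y) z) →
    T (inΓ I 2 (inj₂ x') (inj₂ y')) → T (inΓ I i (inj₂ x') z') → T (inΓ I i (inj₂ y') z') →
    commonCount i x y z ≡ commonCount i x' y' z'
  homAt-constant _ (_ , hom) x y z x' y' z' xy xz yz x'y' x'z' y'z' =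
    trans (hom x y z xy xz yz) (sym (hom x' y' z' x'y' x'z' y'z'))

  homAt1 : HomAt 1
  homAt1 = 1 , count
    where
    count : ∀ x y z → T (inΓ I 2 (inj₂ x) (inj₂ y)) →
            T (inΓ I 1 (inj₂ x) z) → T (inΓ I 1 (inj₂ y) z) → commonCount 1 x y z ≡ 1
    count x y (inj₂ C) _ xC _  = contradiction xC (¬inΓ₁-bl-bl {x} {C})
    count x y (inj₁ p) _ xp yp = trans (commonCount-points 1 x y (inj₁ p))
      (countF-≡1 (λ w → I w x ∧ I w y ∧ eqF p w) {p}
        (from T-∧ (to (inΓ₁-bl-pt {x}) xp , from T-∧ (to (inΓ₁-bl-pt {y}) yp , eqF-refl p)))
        (λ {w} t → sym (eqF-sound (proj₂ (proj₂ (commonPoint⁻ (eqF p w) t))))))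

  -- In a partial linear space this says exactly that there are no triangles.
  TriangleFree : Set
  TriangleFree = ∀ {p B C C'} → ¬ p ∈ B → p ∈ C → p ∈ C' → Meeting C B → Meeting C' B → C ≡ C'

  -- For the SPBIBDs of the theorem this is t ≥ 1.
  Joinable : Set
  Joinable = ∀ {p B} → ¬ p ∈ B → ∃[ C ] (p ∈ C × Meeting C B)

  isGeneralizedQuadrangle⇒triangleFree : IsGeneralizedQuadrangle I → TriangleFree
  isGeneralizedQuadrangle⇒triangleFree (_ , _ , gq) {p} {B} p∉B pC pC' (q , qC , qB) (q' , q'C' , q'B) =
    countF-≤1⇒unique _ (≤-reflexive (IsPartialGeometry.nonFlag gq p B (¬T⇒T-not p∉B)))
      (from T-∧ (pC , anyF-intro (λ w → I w _ ∧ I w B) (from T-∧ (qC , qB))))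
      (from T-∧ (pC' , anyF-intro (λ w → I w _ ∧ I w B) (from T-∧ (q'C' , q'B))))

module PartialLinearSpace {v b : ℕ} (I : Incidence v b)
                          (meet≤1 : ∀ {B C} → B ≢ C → meet I B C ≤ 1) where

  open IncidenceGraph I

  meeting-point-unique : ∀ {x y p q} → x ≢ y → p ∈ x → p ∈ y → q ∈ x → q ∈ y → p ≡ q
  meeting-point-unique {x} {y} x≢y px py qx qy =
    countF-≤1⇒unique (λ w → I w x ∧ I w y) (meet≤1 x≢y) (from T-∧ (px , py)) (from T-∧ (qx , qy))

  joining-block-unique : ∀ {p q B C} → p ≢ q → p ∈ B → q ∈ B → p ∈ C → q ∈ C → B ≡ C
  joining-block-unique {B = B} {C} p≢q pB qB pC qC with B ≟ C
  ... | yes B≡C = B≡C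
  ... | no  B≢C = contradiction (meeting-point-unique B≢C pB pC qB qC) p≢q

  lam≤1 : ∀ {p q} → p ≢ q → lam I p q ≤ 1
  lam≤1 {p} {q} p≢q = countF-≤1 (λ B → I p B ∧ I q B) λ pqB pqC →
    let pB , qB = to T-∧ pqB
        pC , qC = to T-∧ pqC
    in joining-block-unique p≢q pB qB pC qC

  lam≡1 : ∀ {p q C} → p ≢ q → p ∈ C → q ∈ C → lam I p q ≡ 1
  lam≡1 {p} {q} p≢q pC qC =
    ≤-antisym (lam≤1 p≢q) (countF-≥1 (λ B → I p B ∧ I q B) (from T-∧ (pC , qC)))

  commonCount≡1 : ∀ i {x y p} z → x ≢ y → p ∈ x → p ∈ y → T (inΓ I (i ∸ 1) z (inj₁ p)) →
                  commonCount i x y z ≡ 1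
  commonCount≡1 i {x} {y} {p} z x≢y px py zp = trans (commonCount-points i x y z)
    (countF-≡1 (λ w → I w x ∧ I w y ∧ inΓ I (i ∸ 1) z (inj₁ w)) {p}
      (from T-∧ (px , from T-∧ (py , zp)))
      λ {w} t → let wx , wy , _ = commonPoint⁻ (inΓ I (i ∸ 1) z (inj₁ w)) t
                in meeting-point-unique x≢y wx wy px py)

  commonCount≡0 : ∀ i {x y p} z → x ≢ y → p ∈ x → p ∈ y → ¬ T (inΓ I (i ∸ 1) z (inj₁ p)) →
                  commonCount i x y z ≡ 0
  commonCount≡0 i {x} {y} {p} z x≢y px py ¬zp = trans (commonCount-points i x y z)
    (countF-≡0 (λ w → I w x ∧ I w y ∧ inΓ I (i ∸ 1) z (inj₁ w)) λ w t →
      let wx , wy , zw = commonPoint⁻ (inΓ I (i ∸ 1) z (inj₁ w)) t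
      in ¬zp (subst (λ q → T (inΓ I (i ∸ 1) z (inj₁ q))) (meeting-point-unique x≢y wx wy px py) zw))

  triangle-closes : TriangleFree → ∀ {x y C p} → x ≢ y → x ≢ C → p ∈ x → p ∈ y →
                    Meeting x C → Meeting y C → p ∈ C
  triangle-closes tf {x} {y} {C} {p} x≢y x≢C px py (q , qx , qC) (q' , q'y , q'C) with q ≟ p
  ... | yes q≡p = subst (_∈ C) q≡p qC
  ... | no  q≢p = contradiction (tf q∉y qx qC (p , px , py) (q' , q'C , q'y)) x≢C
    where
    q∉y : ¬ q ∈ y
    q∉y qy = q≢p (meeting-point-unique x≢y qx qy px py)

  triangleFree⇒homAt2 : TriangleFree → HomAt 2
  triangleFree⇒homAt2 tf = 1 , count
    where
    count : ∀ x y z → T (inΓ I 2 (inj₂ x) (inj₂ y)) →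
            T (inΓ I 2 (inj₂ x) z) → T (inΓ I 2 (inj₂ y) z) → commonCount 2 x y z ≡ 1
    count x y (inj₁ q) _ xq _ = contradiction xq (¬inΓ₂-bl-pt {x} {q})
    count x y (inj₂ C) xy xC yC =
      let x≢y , p , px , py = to (inΓ₂-bl-bl {x} {y}) xy
          x≢C , xmC = to (inΓ₂-bl-bl {x} {C}) xC
          _ , ymC = to (inΓ₂-bl-bl {y} {C}) yC
          pC = triangle-closes tf x≢y x≢C px py xmC ymC
      in commonCount≡1 2 (inj₂ C) x≢y px py (from (inΓ₁-bl-pt {C} {p}) pC)

  triangleFree⇒isPartialGeometry : ∀ {r k} →
    (∀ p → countF (λ B → I p B) ≡ r) → (∀ B → countF (λ p → I p B) ≡ k) →
    Joinable → TriangleFree → IsPartialGeometry I r k 1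
  triangleFree⇒isPartialGeometry replication blockSize joinable tf = record
    { replication = replication
    ; blockSize   = blockSize
    ; atMostOne   = λ p q p≢q → lam≤1 p≢q
    ; nonFlag     = nonFlag
    }
    where
    nonFlag : ∀ p B → T (not (I p B)) → countF (λ C → I p C ∧ anyF (λ q → I q C ∧ I q B)) ≡ 1
    nonFlag p B ¬pB =
      let p∉B = T-not⇒¬T ¬pB
          C , pC , q , qC , qB = joinable p∉B
      in countF-≡1 (λ C → I p C ∧ anyF (λ q → I q C ∧ I q B)) {C}
           (from T-∧ (pC , anyF-intro (λ q → I q C ∧ I q B) (from T-∧ (qC , qB))))
           λ {C'} t → let pC' , meets = to T-∧ t
                          q' , q'C'∧q'B = anyF-witness (λ q → I q C' ∧ I q B) meets
                      in tf p∉B pC' pC (q' , to T-∧ q'C'∧q'B) (q , qC , qB)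

  module Nondegenerate (secondPoint : ∀ B p → ∃[ q ] (q ∈ B × q ≢ p))
           (thirdBlock : ∀ p B B' → ∃[ C ] (p ∈ C × C ≢ B × C ≢ B')) where

    homAt2⇒triangleFree : HomAt 2 → TriangleFree
    homAt2⇒triangleFree hom {p} {B} {C} {C'} p∉B pC pC' CmB C'mB with C ≟ C'
    ... | yes C≡C' = C≡C'
    ... | no  C≢C' with thirdBlock p C C'
    ...   | D , pD , D≢C , D≢C' = contradiction (trans (sym throughD) (trans sameCount avoidingB)) λ ()
      where
      Γ₂ : ∀ {E F} → E ≢ F → Meeting E F → T (inΓ I 2 (inj₂ E) (inj₂ F))
      Γ₂ {E} {F} E≢F EmF = from (inΓ₂-bl-bl {E} {F}) (E≢F , EmF)
      C≢B : ∀ {E} → p ∈ E → E ≢ B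
      C≢B pE refl = p∉B pE
      CC' : T (inΓ I 2 (inj₂ C) (inj₂ C'))
      CC' = Γ₂ C≢C' (p , pC , pC')
      sameCount : commonCount 2 C C' (inj₂ D) ≡ commonCount 2 C C' (inj₂ B)
      sameCount = homAt-constant 2 hom C C' (inj₂ D) C C' (inj₂ B)
        CC' (Γ₂ (≢-sym D≢C) (p , pC , pD)) (Γ₂ (≢-sym D≢C') (p , pC' , pD))
        CC' (Γ₂ (C≢B pC) CmB) (Γ₂ (C≢B pC') C'mB)
      throughD : commonCount 2 C C' (inj₂ D) ≡ 1
      throughD = commonCount≡1 2 (inj₂ D) C≢C' pC pC' (from (inΓ₁-bl-pt {D} {p}) pD)
      avoidingB : commonCount 2 C C' (inj₂ B) ≡ 0
      avoidingB = commonCount≡0 2 (inj₂ B) C≢C' pC pC' (λ Bp → p∉B (to (inΓ₁-bl-pt {B} {p}) Bp))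

    homUpTo2⇒triangleFree : HomUpTo I 2 → TriangleFree
    homUpTo2⇒triangleFree hom = homAt2⇒triangleFree (hom 2 (s≤s z≤n) ≤-refl)

    triangleFree⇒homUpTo2 : TriangleFree → HomUpTo I 2
    triangleFree⇒homUpTo2 tf 1 _ _ = homAt1
    triangleFree⇒homUpTo2 tf 2 _ _ = triangleFree⇒homAt2 tf
    triangleFree⇒homUpTo2 _ (suc (suc (suc _))) _ (s≤s (s≤s ()))

    module _ {x y p} (x≢y : x ≢ y) (px : p ∈ x) (py : p ∈ y) where

      collinear-at-distance-3 : ∃[ z ] (T (inΓ I 3 (inj₂ x) (inj₁ z)) × T (inΓ I 3 (inj₂ y) (inj₁ z)) ×
                                        commonCount 3 x y (inj₁ z) ≡ 1)
      collinear-at-distance-3 with thirdBlock p x y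
      ... | C , pC , C≢x , C≢y with secondPoint C p
      ...   | z , zC , z≢p =
        z , inΓ₃-bl-pt⁺ (p , px , pC) zC (z∉ C≢x px) , inΓ₃-bl-pt⁺ (p , py , pC) zC (z∉ C≢y py) ,
        commonCount≡1 3 (inj₁ z) x≢y px py (from (inΓ₂-pt-pt {z} {p}) (z≢p , C , zC , pC))
        where
        z∉ : ∀ {E} → C ≢ E → p ∈ E → ¬ z ∈ E
        z∉ C≢E pE zE = C≢E (joining-block-unique z≢p zC pC zE pE)

      noncollinear-at-distance-3 : TriangleFree → Joinable →
        ∃[ u ] (T (inΓ I 3 (inj₂ x) (inj₁ u)) × T (inΓ I 3 (inj₂ y) (inj₁ u)) ×
                commonCount 3 x y (inj₁ u) ≡ 0)
      -- u lies on a block m through a second point q of x; by triangle-freeness m is the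
      -- only block through u meeting x, and m misses p.
      noncollinear-at-distance-3 tf joinable with secondPoint x p
      ... | q , qx , q≢p with thirdBlock q x x
      ...   | m , qm , m≢x , _ with secondPoint m q
      ...     | u , um , u≢q =
        u , inΓ₃-bl-pt⁺ (q , qx , qm) um u∉x , yu ,
        commonCount≡0 3 (inj₁ u) x≢y px py (λ up → ¬collinear (proj₂ (to (inΓ₂-pt-pt {u} {p}) up)))
        where
        u∉x : ¬ u ∈ x
        u∉x ux = m≢x (joining-block-unique u≢q um qm ux qx)
        ¬collinear : ¬ Collinear u p
        ¬collinear (C , uC , pC) = m≢x (joining-block-unique (≢-sym q≢p) pm qm px qx)
          where
          pm : p ∈ m
          pm = subst (p ∈_) (tf u∉x uC um (p , pC , px) (q , qm , qx)) pC
        u∉y : ¬ u ∈ y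
        u∉y uy = ¬collinear (y , uy , py)
        yu : T (inΓ I 3 (inj₂ y) (inj₁ u))
        yu = let C , uC , w , wC , wy = joinable u∉y in inΓ₃-bl-pt⁺ (w , wy , wC) uC u∉y

      ¬homAt3 : TriangleFree → Joinable → ¬ HomAt 3
      ¬homAt3 tf joinable hom =
        let z , xz , yz , one  = collinear-at-distance-3
            u , xu , yu , none = noncollinear-at-distance-3 tf joinable
            sameCount = homAt-constant 3 hom x y (inj₁ z) x y (inj₁ u) xy xz yz xy xu yu
        in contradiction (trans (sym one) (trans sameCount none)) λ ()
        where
        xy : T (inΓ I 2 (inj₂ x) (inj₂ y))
        xy = from (inΓ₂-bl-bl {x} {y}) (x≢y , p , px , py)

module QuasiSymmetric01 {v b : ℕ} {I : Incidence v b} {r k λ₁ t : ℕ}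
  (S : IsSPBIBD I r k λ₁ 0 (k ∸ 1) t) (Q : IsQuasiSymmetric I 0 1) (r≥3 : 3 ≤ r) where

  open IncidenceGraph I
  private
    module S = IsSPBIBD S
    module Q = IsQuasiSymmetric Q

  meet≤1 : ∀ {B C} → B ≢ C → meet I B C ≤ 1
  meet≤1 {B} {C} B≢C =
    [ (λ meet≡0 → ≤-trans (≤-reflexive meet≡0) z≤n) , ≤-reflexive ] (Q.twoVals B C B≢C)

  open PartialLinearSpace I meet≤1

  secondPoint : ∀ B p → ∃[ q ] (q ∈ B × q ≢ p)
  secondPoint B p = countF-other (λ q → I q B) p (subst (2 ≤_) (sym (S.blockSize B)) S.k≥2)

  thirdBlock : ∀ p B B' → ∃[ C ] (p ∈ C × C ≢ B × C ≢ B')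
  thirdBlock p B B' = countF-other₂ (λ C → I p C) B B' (subst (3 ≤_) (sym (S.replication p)) r≥3)

  meetingPair : ∃[ x ] ∃[ y ] (x ≢ y × Meeting x y)
  meetingPair =
    let x , y , x≢y , meet≡1 = Q.yOccurs
        p , pxy = countF-witness (λ w → I w x ∧ I w y) (≤-reflexive (sym meet≡1))
    in x , y , x≢y , p , to T-∧ pxy

  λ₁≡1 : λ₁ ≡ 1
  λ₁≡1 with meetingPair
  ... | x , _ , _ , p , px , _ with secondPoint x p
  ...   | q , qx , q≢p with S.pairs q p q≢p
  ...     | inj₁ lam≡λ₁ = trans (sym lam≡λ₁) (lam≡1 q≢p qx px)
  ...     | inj₂ lam≡0  = contradiction (trans (sym lam≡0) (lam≡1 q≢p qx px)) λ ()

  t≥1 : 1 ≤ t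
  t≥1 with meetingPair
  ... | x , y , x≢y , p , px , py with secondPoint x p
  ...   | q , qx , q≢p = subst (1 ≤_) (S.nonFlagCond q y (¬T⇒T-not q∉y))
    (countF-≥1 (λ w → I w y ∧ not (eqF w q) ∧ ⌊ lam I q w ≟ℕ λ₁ ⌋) {p}
      (from T-∧ (py , from T-∧ (eqF-≢ (≢-sym q≢p) , fromWitness lam≡λ₁))))
    where
    q∉y : ¬ q ∈ y
    q∉y qy = q≢p (meeting-point-unique x≢y qx qy px py)
    lam≡λ₁ : lam I q p ≡ λ₁
    lam≡λ₁ = trans (lam≡1 q≢p qx px) (sym λ₁≡1)

  joinable : Joinable
  joinable {p} {B} p∉B =
    let q , qFlagged = countF-witness (λ q → I q B ∧ not (eqF q p) ∧ ⌊ lam I p q ≟ℕ λ₁ ⌋)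
                                  (subst (1 ≤_) (sym (S.nonFlagCond p B (¬T⇒T-not p∉B))) t≥1)
        qB , rest = to (T-∧ {I q B}) qFlagged
        lam≡λ₁ = toWitness {a? = lam I p q ≟ℕ λ₁} (proj₂ (to (T-∧ {not (eqF q p)}) rest))
        C , pC∧qC = countF-witness (λ C → I p C ∧ I q C) (≤-reflexive (sym (trans lam≡λ₁ λ₁≡1)))
        pC , qC = to T-∧ pC∧qC
    in C , pC , q , qC , qB

proposition4p13 : ∀ {v b : ℕ} (I : Incidence v b) (r k λ₁ t : ℕ) →
    IsSPBIBD I r k λ₁ 0 (k ∸ 1) t →
    IsQuasiSymmetric I 0 1 →
    3 ≤ r →
    (IsAlmost2BHomogeneous I 4 ⇔ IsGeneralizedQuadrangle I) × ¬ Is2BHomogeneous I 4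
proposition4p13 I r k λ₁ t S Q r≥3 = mk⇔ almostHomogeneous⇒GQ GQ⇒almostHomogeneous , ¬homogeneous
  where
  open IsSPBIBD S using (replication; blockSize)
  open QuasiSymmetric01 S Q r≥3
  open IncidenceGraph I
  open PartialLinearSpace I meet≤1
  open Nondegenerate secondPoint thirdBlock

  almostHomogeneous⇒GQ : IsAlmost2BHomogeneous I 4 → IsGeneralizedQuadrangle I
  almostHomogeneous⇒GQ hom =
    r , k , triangleFree⇒isPartialGeometry replication blockSize joinable (homUpTo2⇒triangleFree hom)

  GQ⇒almostHomogeneous : IsGeneralizedQuadrangle I → IsAlmost2BHomogeneous I 4
  GQ⇒almostHomogeneous gq = triangleFree⇒homUpTo2 (isGeneralizedQuadrangle⇒triangleFree gq)

  ¬homogeneous : ¬ Is2BHomogeneous I 4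
  ¬homogeneous hom with meetingPair
  ... | x , y , x≢y , p , px , py = ¬homAt3 x≢y px py triangleFree joinable (hom 3 (s≤s z≤n) ≤-refl)
    where
    triangleFree : TriangleFree
    triangleFree = homUpTo2⇒triangleFree (λ i 1≤i i≤2 → hom i 1≤i (≤-trans i≤2 (n≤1+n 2)))
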